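{- Let $\Gamma$ be a weakly distance-regular digraph whose attached scheme is commutative, let $q\ge3$, and let $(x_0,x_1,\dots,x_{q-1})$ be a circuit (i.e. $x_j\to x_{j+1}$ are arcs, indices modulo $q$, vertices distinct) all of whose arcs are of type $(1,q-1)$. Suppose $k_{(1,q-1)}=k_{(2,q-2)}$. For each $i$ (indices modulo $q$) let \[Y_i=\{w\in V\Gamma : \tilde\partial(x_{i-1},w)=(1,q-1),\ \tilde\partial(w,x_{i+1})=(1,q-1)\}.\] Then \[Y_i=\{w:\tilde\partial(x_{i-2},w)=(2,q-2),\ \tilde\partial(w,x_{i-1})=(q-1,1)\}=\{w:\tilde\partial(x_{i+1},w)=(q-1,1),\ \tilde\partial(w,x_{i+2})=(2,q-2)\}.\] Moreover, if $q>3$ and $\Gamma$ is a Cayley digraph over an additive (abelian) group, then $Y_i-x_{i-1}=Y_{i+1}-x_i$.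
   Context: Digraphs are finite and simple. $\partial(x,y)$ is the directed distance and $\tilde\partial(x,y)=(\partial(x,y),\partial(y,x))$; an arc $(u,v)$ is of type $(1,r)$ if $\partial(v,u)=r$. A strongly connected digraph $\Gamma$ is weakly distance-regular if the relations $\Gamma_{\tilde i}=\{(x,y):\tilde\partial(x,y)=\tilde i\}$, $\tilde i\in\tilde\partial(\Gamma)=\{\tilde\partial(x,y)\}$, form an association scheme (the attached scheme); $k_{\tilde i}=|\{y:\tilde\partial(x,y)=\tilde i\}|$ is the valency of $\Gamma_{\tilde i}$. The Cayley digraph $\mathrm{Cay}(H,S)$ of an additive group $H$ has vertex set $H$ and arcs $x\to y$ whenever $y-x\in S$. For $Y\subseteq H$ and $a\in H$, $Y-a=\{y-a:y\in Y\}$. -}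

module Defs where

open import Data.Nat using (ℕ; zero; suc; _+_; _∸_; _<_)
open import Data.Nat.Properties using (_≟_)
open import Data.Fin using (Fin)
open import Data.Bool using (Bool; true; false; if_then_else_; _∧_)
open import Data.List using (List; allFin; map)
open import Data.Bool.ListAction using (any)
open import Data.Nat.ListAction using (sum)
open import Data.Product using (_×_; _,_; Σ; ∃)
open import Data.Product.Properties using (≡-dec)
open import Relation.Nullary.Decidable using (⌊_⌋)
open import Relation.Binary.PropositionalEquality using (_≡_)
open import Algebra.Structures using (IsAbelianGroup)

record Digraph : Set where
  field
    n        : ℕ
    adj      : Fin n → Fin n → Bool
    loopless : ∀ x → adj x x ≡ false

module _ (Γ : Digraph) where
  open Digraph Γ

  V : Set
  V = Fin n

  reach : ℕ → V → V → Bool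
  reach zero    x y = ⌊ Data.Fin._≟_ x y ⌋
  reach (suc m) x y = any (λ z → adj x z ∧ reach m z y) (allFin n)

  -- least m (starting from m, with fuel f) such that reach m x y;
  -- returns the value reached when the fuel runs out (unreachable case)
  distFrom : ℕ → ℕ → V → V → ℕ
  distFrom m zero    x y = m
  distFrom m (suc f) x y = if reach m x y then m else distFrom (suc m) f x y

  -- directed distance ∂(x,y) = length of a shortest walk from x to y
  -- (a shortest walk has length < n whenever y is reachable from x)
  ∂ : V → V → ℕ
  ∂ x y = distFrom 0 n x y

  ∂̃ : V → V → ℕ × ℕ
  ∂̃ x y = ∂ x y , ∂ y x

  _==_ : ℕ × ℕ → ℕ × ℕ → Bool
  i == j = ⌊ ≡-dec _≟_ _≟_ i j ⌋

  count : (V → Bool) → ℕ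
  count P = sum (map (λ z → if P z then 1 else 0) (allFin n))

  StronglyConnected : Set
  StronglyConnected = ∀ x y → ∃ λ m → reach m x y ≡ true

  p : ℕ × ℕ → ℕ × ℕ → V → V → ℕ
  p i j x y = count (λ z → (∂̃ x z == i) ∧ (∂̃ z y == j))

  -- The relations Γ_ĩ form an association scheme: (identity relation Γ_(0,0),
  -- partition and closure under transposition hold automatically);
  -- the intersection numbers p^h_{ij} are well defined.
  IsSchemeWDR : Set
  IsSchemeWDR = ∀ i j h x y x' y' → ∂̃ x y ≡ h → ∂̃ x' y' ≡ h
                → p i j x y ≡ p i j x' y'

  WeaklyDistanceRegular : Set
  WeaklyDistanceRegular = StronglyConnected × IsSchemeWDR

  CommutativeScheme : Set
  CommutativeScheme = ∀ i j x y → p i j x y ≡ p j i x y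

  -- valency k_ĩ computed at vertex x (independent of x in a scheme)
  valency : V → ℕ × ℕ → ℕ
  valency x i = count (λ y → ∂̃ x y == i)

  record CayleyStructure : Set where
    field
      _⊕_     : V → V → V
      𝟘       : V
      ⊖_      : V → V
      isAbGrp : IsAbelianGroup _≡_ _⊕_ 𝟘 ⊖_
      S       : V → Bool
      arcs    : ∀ x y → adj x y ≡ S (y ⊕ (⊖ x))

    _-ˢ_ : (V → Set) → V → (V → Set)
    (Y -ˢ a) u = Σ V λ y → Y y × u ≡ y ⊕ (⊖ a)

  -- Y(a,b) = { w : ∂̃(a,w) = (1,q-1), ∂̃(w,b) = (1,q-1) }   (a = x_{i-1}, b = x_{i+1})
  Yset : ℕ → V → V → V → Set
  Yset q a b w = ∂̃ a w ≡ (1 , q ∸ 1) × ∂̃ w b ≡ (1 , q ∸ 1)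

  record Circuit (q : ℕ) : Set where
    field
      x        : ℕ → V
      periodic : ∀ j → x (j + q) ≡ x j
      distinct : ∀ i j → i < q → j < q → x i ≡ x j → i ≡ j
      arc      : ∀ j → adj (x j) (x (suc j)) ≡ true
      type1    : ∀ j → ∂̃ (x j) (x (suc j)) ≡ (1 , q ∸ 1)

-- For w ∈ Y_i the triangle inequality along the circuit puts w in the two other sets.
-- All three sets are counted by intersection numbers, and double counting the pairs
-- (w , u) around x_{i-2} gives k_(1,q-1) p^(1,q-1)_{(2,q-2),(q-1,1)} = k_(2,q-2) p^(2,q-2)_{(1,q-1),(1,q-1)};
-- so equal valencies (and commutativity, for the third set) make the inclusions equalities.
-- In a Cayley digraph translations are automorphisms. Translating Y_i by x_i - x_{i-1}
-- gives a set Y' through x_i, and for q > 3 both Y' and Y_{i+1} lie in, hence equal,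
-- the set {w : ∂̃(d,w) = (2,q-2), ∂̃(w,x_i) = (q-1,1)} for the translate d = x_i + x_{i+2} - x_{i+3}.
module Submission where

open import Algebra.Bundles using (AbelianGroup)
import Algebra.Properties.AbelianGroup
import Algebra.Properties.CommutativeSemigroup
open import Algebra.Structures using (IsAbelianGroup)
open import Data.Bool using (Bool; true; false; T; if_then_else_; _∧_)
open import Data.Bool.Properties using (T-∧; ∧-assoc; ∧-comm)
open import Data.Empty using (⊥-elim)
open import Data.Fin using (Fin)
import Data.Fin as Fin
open import Data.List using (List; []; _∷_; map; allFin)
open import Data.List.Membership.Propositional using (_∈_; lose)
open import Data.List.Membership.Propositional.Properties using (∈-allFin)
open import Data.List.Properties using (map-cong)
open import Data.List.Relation.Unary.Any using (here; there; satisfied)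
open import Data.List.Relation.Unary.Any.Properties using (any⁺; any⁻)
open import Data.Nat using (ℕ; zero; suc; _+_; _*_; _∸_; _≤_; _<_; z≤n; s≤s; s≤s⁻¹; >-nonZero)
open import Data.Nat.ListAction using (sum)
open import Data.Nat.Properties
open import Data.Product using (_×_; _,_; ∃; proj₁; proj₂; swap)
open import Data.Sum using (inj₁; inj₂)
open import Data.Unit using (tt)
open import Function using (_∘_; _⇔_; mk⇔; Equivalence)
import Function.Properties.Equivalence as ⇔
open import Level using (0ℓ)
open import Relation.Nullary using (¬_; yes; no; contradiction)
open import Relation.Nullary.Decidable using (toWitness; fromWitness)
open import Relation.Binary.PropositionalEquality
  using (_≡_; _≢_; _≗_; refl; sym; trans; cong; cong₂; subst; subst₂; module ≡-Reasoning)

open import Defs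

T-injective : ∀ {a b} → (T a → T b) → (T b → T a) → a ≡ b
T-injective {false} {false} _   _   = refl
T-injective {false} {true}  _   b⇒a = ⊥-elim (b⇒a tt)
T-injective {true}  {false} a⇒b _   = ⊥-elim (a⇒b tt)
T-injective {true}  {true}  _   _   = refl

∧-leftComm : ∀ a b c → a ∧ (b ∧ c) ≡ b ∧ (a ∧ c)
∧-leftComm a b c = trans (sym (∧-assoc a b c)) (trans (cong (_∧ c) (∧-comm a b)) (∧-assoc b a c))

module _ {A : Set} where

  sumOver : List A → (A → ℕ) → ℕ
  sumOver xs f = sum (map f xs)

  countIn : List A → (A → Bool) → ℕ
  countIn xs P = sumOver xs (λ z → if P z then 1 else 0)

  sumOver-cong : ∀ xs {f g : A → ℕ} → f ≗ g → sumOver xs f ≡ sumOver xs g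
  sumOver-cong xs f≗g = cong sum (map-cong f≗g xs)

  countIn-cong : ∀ xs {P Q : A → Bool} → P ≗ Q → countIn xs P ≡ countIn xs Q
  countIn-cong xs P≗Q = sumOver-cong xs (cong (λ b → if b then 1 else 0) ∘ P≗Q)

  sumOver-zero : ∀ xs → sumOver xs (λ _ → 0) ≡ 0
  sumOver-zero []       = refl
  sumOver-zero (_ ∷ xs) = sumOver-zero xs

  sumOver-+ : ∀ xs (f g : A → ℕ) → sumOver xs (λ z → f z + g z) ≡ sumOver xs f + sumOver xs g
  sumOver-+ []       f g = refl
  sumOver-+ (y ∷ xs) f g = trans (cong (f y + g y +_) (sumOver-+ xs f g))
                                 (+-interchange (f y) (g y) (sumOver xs f) (sumOver xs g))
    where open Algebra.Properties.CommutativeSemigroup +-commutativeSemigroup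
            renaming (interchange to +-interchange)

  sumOver-comm : ∀ xs ys (F : A → A → ℕ)
    → sumOver xs (λ a → sumOver ys (F a)) ≡ sumOver ys (λ b → sumOver xs (λ a → F a b))
  sumOver-comm []       ys F = sym (sumOver-zero ys)
  sumOver-comm (x ∷ xs) ys F =
    trans (cong (sumOver ys (F x) +_) (sumOver-comm xs ys F))
          (sym (sumOver-+ ys (F x) (λ b → sumOver xs (λ a → F a b))))

  sumOver-if-const : ∀ xs (P : A → Bool) (f : A → ℕ) c → (∀ z → T (P z) → f z ≡ c)
    → sumOver xs (λ z → if P z then f z else 0) ≡ countIn xs P * c
  sumOver-if-const []       P f c f≡c = refl
  sumOver-if-const (y ∷ xs) P f c f≡c with P y | f≡c y
  ... | true  | fy≡c = cong₂ _+_ (fy≡c tt) (sumOver-if-const xs P f c f≡c)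
  ... | false | _    = sumOver-if-const xs P f c f≡c

  countIn-∧ˡ : ∀ xs b (P : A → Bool) → countIn xs (λ z → b ∧ P z) ≡ (if b then countIn xs P else 0)
  countIn-∧ˡ xs true  P = refl
  countIn-∧ˡ xs false P = sumOver-zero xs

  countIn-mono : ∀ xs {P Q : A → Bool} → (∀ z → T (P z) → T (Q z)) → countIn xs P ≤ countIn xs Q
  countIn-mono []       P⇒Q = z≤n
  countIn-mono (y ∷ xs) {P} {Q} P⇒Q with P y | Q y | P⇒Q y
  ... | true  | true  | _     = s≤s (countIn-mono xs P⇒Q)
  ... | true  | false | Py⇒Qy = ⊥-elim (Py⇒Qy tt)
  ... | false | _     | _     = ≤-trans (countIn-mono xs P⇒Q) (m≤n+m _ _)

  countIn-mono-< : ∀ xs {P Q : A → Bool} → (∀ z → T (P z) → T (Q z))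
    → ∀ {z} → z ∈ xs → T (Q z) → ¬ T (P z) → countIn xs P < countIn xs Q
  countIn-mono-< (y ∷ xs) {P} {Q} P⇒Q (here refl) Qz ¬Pz with P y | Q y
  ... | true  | _     = ⊥-elim (¬Pz tt)
  ... | false | true  = s≤s (countIn-mono xs P⇒Q)
  ... | false | false = ⊥-elim Qz
  countIn-mono-< (y ∷ xs) {P} {Q} P⇒Q (there z∈xs) Qz ¬Pz with P y | Q y | P⇒Q y
  ... | true  | true  | _     = s≤s (countIn-mono-< xs P⇒Q z∈xs Qz ¬Pz)
  ... | true  | false | Py⇒Qy = ⊥-elim (Py⇒Qy tt)
  ... | false | _     | _     = <-≤-trans (countIn-mono-< xs P⇒Q z∈xs Qz ¬Pz) (m≤n+m _ _)

  countIn-≤⇒⊇ : ∀ xs {P Q : A → Bool} → (∀ z → T (P z) → T (Q z)) → countIn xs Q ≤ countIn xs P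
    → ∀ {z} → z ∈ xs → T (Q z) → T (P z)
  countIn-≤⇒⊇ xs {P} P⇒Q Q≤P {z} z∈xs Qz with P z in Pz≡
  ... | true  = tt
  ... | false = contradiction Q≤P (<⇒≱ (countIn-mono-< xs P⇒Q z∈xs Qz (subst T Pz≡)))

  countIn-pos : ∀ xs {P : A → Bool} {z} → z ∈ xs → T (P z) → 0 < countIn xs P
  countIn-pos (y ∷ xs) {P} (here refl) Pz with P y
  ... | true = s≤s z≤n
  countIn-pos (y ∷ xs) (there z∈xs) Pz = <-≤-trans (countIn-pos xs z∈xs Pz) (m≤n+m _ _)

open Digraph using (adj)

module _ (Γ : Digraph) where
  open Digraph Γ using (n)

  reach-zero⁻ : ∀ {x y} → T (reach Γ 0 x y) → x ≡ y
  reach-zero⁻ = toWitness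

  reach-zero⁺ : ∀ x → T (reach Γ 0 x x)
  reach-zero⁺ x = fromWitness refl

  reach-suc⁻ : ∀ m {x y} → T (reach Γ (suc m) x y) → ∃ λ z → T (adj Γ x z) × T (reach Γ m z y)
  reach-suc⁻ m {x} {y} r with satisfied (any⁻ (λ z → adj Γ x z ∧ reach Γ m z y) (allFin n) r)
  ... | z , xz∧zy = z , Equivalence.to T-∧ xz∧zy

  reach-suc⁺ : ∀ m {x y} z → T (adj Γ x z) → T (reach Γ m z y) → T (reach Γ (suc m) x y)
  reach-suc⁺ m {x} {y} z xz zy =
    any⁺ (λ z → adj Γ x z ∧ reach Γ m z y) (lose (∈-allFin z) (Equivalence.from T-∧ (xz , zy)))

  reach-+ : ∀ a b {x y z} → T (reach Γ a x y) → T (reach Γ b y z) → T (reach Γ (a + b) x z)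
  reach-+ zero    b xy yz with reach-zero⁻ xy
  ... | refl = yz
  reach-+ (suc a) b xy yz with reach-suc⁻ a xy
  ... | w , xw , wy = reach-suc⁺ (a + b) w xw (reach-+ a b wy yz)

  distFrom-≤ : ∀ s f x y → distFrom Γ s f x y ≤ s + f
  distFrom-≤ s zero    x y = m≤m+n s 0
  distFrom-≤ s (suc f) x y with reach Γ s x y
  ... | true  = m≤m+n s (suc f)
  ... | false = subst (distFrom Γ (suc s) f x y ≤_) (sym (+-suc s f)) (distFrom-≤ (suc s) f x y)

  distFrom-minimal : ∀ s f m {x y} → s ≤ m → m < s + f → T (reach Γ m x y) → distFrom Γ s f x y ≤ m
  distFrom-minimal s zero    m s≤m m<s+0 _ = contradiction (subst (m <_) (+-identityʳ s) m<s+0) (≤⇒≯ s≤m)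
  distFrom-minimal s (suc f) m {x} {y} s≤m m<s+f r with reach Γ s x y in rs≡ | m≤n⇒m<n∨m≡n s≤m
  ... | true  | _        = s≤m
  ... | false | inj₂ refl = ⊥-elim (subst T rs≡ r)
  ... | false | inj₁ s<m = distFrom-minimal (suc s) f m s<m (subst (m <_) (+-suc s f) m<s+f) r

  distFrom-reach : ∀ s f x y → distFrom Γ s f x y < s + f → T (reach Γ (distFrom Γ s f x y) x y)
  distFrom-reach s zero    x y d<s+0 = contradiction (subst (s <_) (+-identityʳ s) d<s+0) (<-irrefl refl)
  distFrom-reach s (suc f) x y d<s+f with reach Γ s x y in rs≡
  ... | true  = subst T (sym rs≡) tt
  ... | false = distFrom-reach (suc s) f x y (subst (distFrom Γ (suc s) f x y <_) (+-suc s f) d<s+f)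

  ∂-≤-order : ∀ x y → ∂ Γ x y ≤ n
  ∂-≤-order x y = distFrom-≤ 0 n x y

  ∂-minimal : ∀ m {x y} → T (reach Γ m x y) → ∂ Γ x y ≤ m
  ∂-minimal m {x} {y} r with m <? n
  ... | yes m<n = distFrom-minimal 0 n m z≤n m<n r
  ... | no  m≮n = ≤-trans (∂-≤-order x y) (≮⇒≥ m≮n)

  ∂-reach : ∀ {x y} → ∂ Γ x y < n → T (reach Γ (∂ Γ x y) x y)
  ∂-reach {x} {y} = distFrom-reach 0 n x y

  -- An unreachable target has the junk distance n, which also satisfies the triangle inequality.
  ∂-triangle : ∀ x y z → ∂ Γ x z ≤ ∂ Γ x y + ∂ Γ y z
  ∂-triangle x y z with ∂ Γ x y <? n | ∂ Γ y z <? n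
  ... | yes xy<n | yes yz<n = ∂-minimal _ (reach-+ (∂ Γ x y) (∂ Γ y z) (∂-reach xy<n) (∂-reach yz<n))
  ... | no  xy≮n | _        = ≤-trans (∂-≤-order x z) (≤-trans (≮⇒≥ xy≮n) (m≤m+n _ _))
  ... | yes _    | no yz≮n  = ≤-trans (∂-≤-order x z) (≤-trans (≮⇒≥ yz≮n) (m≤n+m _ _))

  ∂-refl : ∀ x → ∂ Γ x x ≡ 0
  ∂-refl x = n≤0⇒n≡0 (∂-minimal 0 (reach-zero⁺ x))

  ∂≡0⇒≡ : ∀ {x y} → ∂ Γ x y ≡ 0 → x ≡ y
  ∂≡0⇒≡ {x} {y} ∂≡0 =
    reach-zero⁻ (subst (λ m → T (reach Γ m x y)) ∂≡0 (∂-reach (subst (_< n) (sym ∂≡0) (0<order x))))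
    where
    0<order : Fin n → 0 < n
    0<order Fin.zero    = s≤s z≤n
    0<order (Fin.suc _) = s≤s z≤n

PreservesAdjacency : (Γ : Digraph) → (V Γ → V Γ) → Set
PreservesAdjacency Γ φ = ∀ x y → adj Γ (φ x) (φ y) ≡ adj Γ x y

module _ (Γ : Digraph) {φ : V Γ → V Γ} (φ-adj : PreservesAdjacency Γ φ) where

  reach-preserved : ∀ m {x y} → T (reach Γ m x y) → T (reach Γ m (φ x) (φ y))
  reach-preserved zero    xy with reach-zero⁻ Γ xy
  ... | refl = reach-zero⁺ Γ (φ _)
  reach-preserved (suc m) xy with reach-suc⁻ Γ m xy
  ... | z , xz , zy = reach-suc⁺ Γ m (φ z) (subst T (sym (φ-adj _ z)) xz) (reach-preserved m zy)

module _ (Γ : Digraph) {φ ψ : V Γ → V Γ} (φ-adj : PreservesAdjacency Γ φ) (ψ-adj : PreservesAdjacency Γ ψ)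
         (ψ∘φ≗id : ∀ x → ψ (φ x) ≡ x) where
  open Digraph Γ using (n)

  reach-invariant : ∀ m x y → reach Γ m (φ x) (φ y) ≡ reach Γ m x y
  reach-invariant m x y = T-injective
    (subst₂ (λ a b → T (reach Γ m a b)) (ψ∘φ≗id x) (ψ∘φ≗id y) ∘ reach-preserved Γ ψ-adj m)
    (reach-preserved Γ φ-adj m)

  distFrom-invariant : ∀ s f x y → distFrom Γ s f (φ x) (φ y) ≡ distFrom Γ s f x y
  distFrom-invariant s zero    x y = refl
  distFrom-invariant s (suc f) x y rewrite reach-invariant s x y | distFrom-invariant (suc s) f x y = refl

  ∂̃-invariant : ∀ x y → ∂̃ Γ (φ x) (φ y) ≡ ∂̃ Γ x y
  ∂̃-invariant x y = cong₂ _,_ (distFrom-invariant 0 n x y) (distFrom-invariant 0 n y x)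

module _ (Γ : Digraph) where
  open Digraph Γ using (n)

  private
    infix 4 _≐_
    _≐_ : ℕ × ℕ → ℕ × ℕ → Bool
    _≐_ = _==_ Γ

    vertices : List (V Γ)
    vertices = allFin n

  ≐⇒≡ : ∀ {i j} → T (i ≐ j) → i ≡ j
  ≐⇒≡ = toWitness

  ≡⇒≐ : ∀ {i j} → i ≡ j → T (i ≐ j)
  ≡⇒≐ = fromWitness

  ≐-swap : ∀ i j → (swap i ≐ swap j) ≡ (i ≐ j)
  ≐-swap i j = T-injective (≡⇒≐ ∘ cong swap ∘ ≐⇒≡) (≡⇒≐ ∘ cong swap ∘ ≐⇒≡)

  Between : ℕ × ℕ → ℕ × ℕ → V Γ → V Γ → V Γ → Set
  Between h j a b w = ∂̃ Γ a w ≡ h × ∂̃ Γ w b ≡ j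

  T-between : ∀ {h j a b w} → T ((∂̃ Γ a w ≐ h) ∧ (∂̃ Γ w b ≐ j)) ⇔ Between h j a b w
  T-between = mk⇔ (λ t → let aw , wb = Equivalence.to T-∧ t in ≐⇒≡ aw , ≐⇒≡ wb)
                  (λ { (aw , wb) → Equivalence.from T-∧ (≡⇒≐ aw , ≡⇒≐ wb) })

  Between-⊇ : ∀ {h j a b h′ j′ a′ b′} → p Γ h′ j′ a′ b′ ≤ p Γ h j a b
    → (∀ w → Between h j a b w → Between h′ j′ a′ b′ w)
    → ∀ w → Between h′ j′ a′ b′ w → Between h j a b w
  Between-⊇ count≤ ⊆ w w∈ = Equivalence.to T-between
    (countIn-≤⇒⊇ vertices (λ z → Equivalence.from T-between ∘ ⊆ z ∘ Equivalence.to T-between)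
                 count≤ (∈-allFin w) (Equivalence.from T-between w∈))

  -- Double counting of the pairs (w , u) with ∂̃(d,w) = h, ∂̃(d,u) = i and ∂̃(w,u) = j.
  valency-duality : IsSchemeWDR Γ → ∀ {h i j d a a′ b′} → ∂̃ Γ d a ≡ h → ∂̃ Γ a′ b′ ≡ i
    → valency Γ d h * p Γ i (swap j) d a ≡ valency Γ d i * p Γ h j a′ b′
  valency-duality scheme {h} {i} {j} {d} {a} {a′} {b′} da≡h a′b′≡i = begin
    valency Γ d h * p Γ i (swap j) d a
      ≡⟨ sumOver-if-const vertices (λ w → ∂̃ Γ d w ≐ h) _ _
           (λ w dw≐h → scheme i (swap j) h d w d a (≐⇒≡ dw≐h) da≡h) ⟨
    sumOver vertices (λ w → if ∂̃ Γ d w ≐ h then p Γ i (swap j) d w else 0)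
      ≡⟨ sumOver-cong vertices (λ w → countIn-∧ˡ vertices (∂̃ Γ d w ≐ h) _) ⟨
    sumOver vertices (λ w → sumOver vertices (pair w))
      ≡⟨ sumOver-comm vertices vertices pair ⟩
    sumOver vertices (λ u → sumOver vertices (λ w → pair w u))
      ≡⟨ sumOver-cong vertices (λ u → trans (countIn-cong vertices (reorder u))
                                            (countIn-∧ˡ vertices (∂̃ Γ d u ≐ i) _)) ⟩
    sumOver vertices (λ u → if ∂̃ Γ d u ≐ i then p Γ h j d u else 0)
      ≡⟨ sumOver-if-const vertices (λ u → ∂̃ Γ d u ≐ i) _ _
           (λ u du≐i → scheme h j i d u a′ b′ (≐⇒≡ du≐i) a′b′≡i) ⟩
    valency Γ d i * p Γ h j a′ b′ ∎
    where
    open ≡-Reasoning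
    pair : V Γ → V Γ → ℕ
    pair w u = if (∂̃ Γ d w ≐ h) ∧ ((∂̃ Γ d u ≐ i) ∧ (∂̃ Γ u w ≐ swap j)) then 1 else 0
    reorder : ∀ u w → ((∂̃ Γ d w ≐ h) ∧ ((∂̃ Γ d u ≐ i) ∧ (∂̃ Γ u w ≐ swap j)))
                    ≡ ((∂̃ Γ d u ≐ i) ∧ ((∂̃ Γ d w ≐ h) ∧ (∂̃ Γ w u ≐ j)))
    reorder u w = trans (∧-leftComm (∂̃ Γ d w ≐ h) (∂̃ Γ d u ≐ i) (∂̃ Γ u w ≐ swap j))
                        (cong (λ b → (∂̃ Γ d u ≐ i) ∧ ((∂̃ Γ d w ≐ h) ∧ b)) (≐-swap (∂̃ Γ w u) j))

  p-duality : IsSchemeWDR Γ → ∀ {h i j d a a′ b′} → valency Γ d h ≡ valency Γ d i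
    → ∂̃ Γ d a ≡ h → ∂̃ Γ a′ b′ ≡ i → p Γ i (swap j) d a ≡ p Γ h j a′ b′
  p-duality scheme {h} {i} {j} {d} {a} kh≡ki da≡h a′b′≡i =
    *-cancelˡ-≡ _ _ (valency Γ d h) {{>-nonZero (countIn-pos vertices (∈-allFin a) (≡⇒≐ da≡h))}}
      (trans (valency-duality scheme {j = j} da≡h a′b′≡i) (cong (_* _) (sym kh≡ki)))

  Between-⇔-via-predecessor : IsSchemeWDR Γ → ∀ {h i j d a b} → valency Γ d h ≡ valency Γ d i
    → ∂̃ Γ d a ≡ h → ∂̃ Γ a b ≡ i
    → (∀ w → Between h j a b w → Between i (swap j) d a w)
    → ∀ w → Between h j a b w ⇔ Between i (swap j) d a w
  Between-⇔-via-predecessor scheme kh≡ki da≡h ab≡i ⊆ w =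
    mk⇔ (⊆ w) (Between-⊇ (≤-reflexive (p-duality scheme kh≡ki da≡h ab≡i)) ⊆ w)

  Between-⇔-via-successor : IsSchemeWDR Γ → CommutativeScheme Γ → ∀ {h i j d a b e}
    → valency Γ d h ≡ valency Γ d i → ∂̃ Γ d a ≡ h → ∂̃ Γ a b ≡ i → ∂̃ Γ b e ≡ h
    → (∀ w → Between h j a b w → Between (swap j) i b e w)
    → ∀ w → Between h j a b w ⇔ Between (swap j) i b e w
  Between-⇔-via-successor scheme comm {h} {i} {j} {d} {a} {b} {e} kh≡ki da≡h ab≡i be≡h ⊆ w =
    mk⇔ (⊆ w) (Between-⊇ (≤-reflexive count≡) ⊆ w)
    where
    count≡ : p Γ (swap j) i b e ≡ p Γ h j a b
    count≡ = begin
      p Γ (swap j) i b e ≡⟨ scheme (swap j) i h b e d a be≡h da≡h ⟩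
      p Γ (swap j) i d a ≡⟨ comm (swap j) i d a ⟩
      p Γ i (swap j) d a ≡⟨ p-duality scheme kh≡ki da≡h ab≡i ⟩
      p Γ h j a b        ∎
      where open ≡-Reasoning

≤2-≢0-≢1⇒≡2 : ∀ {m} → m ≤ 2 → m ≢ 0 → m ≢ 1 → m ≡ 2
≤2-≢0-≢1⇒≡2 {zero}        _ m≢0 _   = contradiction refl m≢0
≤2-≢0-≢1⇒≡2 {suc zero}    _ _   m≢1 = contradiction refl m≢1
≤2-≢0-≢1⇒≡2 {suc (suc zero)} _ _ _  = refl
≤2-≢0-≢1⇒≡2 {suc (suc (suc _))} (s≤s (s≤s ())) _ _

-- Here q = 3 + r: A₁ is the arc type (1 , q - 1) and A₂ the type (2 , q - 2).
module ArcGeometry (Γ : Digraph) (r : ℕ) where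

  A₁ A₂ : ℕ × ℕ
  A₁ = 1 , suc (suc r)
  A₂ = 2 , suc r

  ∂≢1-via-start : ∀ {b u w} → ∂ Γ b u ≤ r → ∂ Γ b w ≡ suc (suc r) → ∂ Γ u w ≢ 1
  ∂≢1-via-start {b} {u} {w} bu≤r bw≡ uw≡1 = 1+n≰n (begin
    suc (suc r)       ≡⟨ bw≡ ⟨
    ∂ Γ b w           ≤⟨ ∂-triangle Γ b u w ⟩
    ∂ Γ b u + ∂ Γ u w ≤⟨ +-mono-≤ bu≤r (≤-reflexive uw≡1) ⟩
    r + 1             ≡⟨ +-comm r 1 ⟩
    suc r             ∎)
    where open ≤-Reasoning

  ∂≢1-via-end : ∀ {u w e} → ∂ Γ w e ≤ r → ∂ Γ u e ≡ suc (suc r) → ∂ Γ u w ≢ 1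
  ∂≢1-via-end {u} {w} {e} we≤r ue≡ uw≡1 = 1+n≰n (begin
    suc (suc r)       ≡⟨ ue≡ ⟨
    ∂ Γ u e           ≤⟨ ∂-triangle Γ u w e ⟩
    ∂ Γ u w + ∂ Γ w e ≤⟨ +-mono-≤ (≤-reflexive uw≡1) we≤r ⟩
    suc r             ∎)
    where open ≤-Reasoning

  two-step : ∀ {u v w} → ∂̃ Γ u v ≡ A₁ → ∂̃ Γ v w ≡ A₁ → ∂ Γ w u ≤ suc r → ∂ Γ u w ≢ 1 → ∂̃ Γ u w ≡ A₂
  two-step {u} {v} {w} uv vw wu≤ uw≢1 = cong₂ _,_ (≤2-≢0-≢1⇒≡2 uw≤2 uw≢0 uw≢1) (≤-antisym wu≤ wu≥)
    where
    open ≤-Reasoning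
    uw≤2 : ∂ Γ u w ≤ 2
    uw≤2 = subst (∂ Γ u w ≤_) (cong₂ _+_ (cong proj₁ uv) (cong proj₁ vw)) (∂-triangle Γ u v w)
    uw≢0 : ∂ Γ u w ≢ 0
    uw≢0 uw≡0 with ∂≡0⇒≡ Γ uw≡0
    ... | refl with trans (sym (cong proj₁ uv)) (cong proj₂ vw)
    ... | ()
    wu≥ : suc r ≤ ∂ Γ w u
    wu≥ = s≤s⁻¹ (begin
      suc (suc r)       ≡⟨ cong proj₂ vw ⟨
      ∂ Γ w v           ≤⟨ ∂-triangle Γ w u v ⟩
      ∂ Γ w u + ∂ Γ u v ≡⟨ cong (∂ Γ w u +_) (cong proj₁ uv) ⟩
      ∂ Γ w u + 1       ≡⟨ +-comm (∂ Γ w u) 1 ⟩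
      suc (∂ Γ w u)     ∎)

  Between-⊆-predecessor : ∀ {d a b} → ∂̃ Γ d a ≡ A₁ → ∂ Γ b d ≤ r
    → ∀ w → Between Γ A₁ A₁ a b w → Between Γ A₂ (swap A₁) d a w
  Between-⊆-predecessor {d} {a} {b} da bd≤r w (aw , wb) =
    two-step da aw wd≤ (∂≢1-via-start bd≤r (cong proj₂ wb)) , cong swap aw
    where
    wd≤ : ∂ Γ w d ≤ suc r
    wd≤ = ≤-trans (∂-triangle Γ w b d) (+-mono-≤ (≤-reflexive (cong proj₁ wb)) bd≤r)

  Between-⊆-successor : ∀ {a b e} → ∂̃ Γ b e ≡ A₁ → ∂ Γ e a ≤ r
    → ∀ w → Between Γ A₁ A₁ a b w → Between Γ (swap A₁) A₂ b e w
  Between-⊆-successor {a} {b} {e} be ea≤r w (aw , wb) =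
    cong swap wb , two-step wb be ew≤ (∂≢1-via-end ea≤r (cong proj₂ aw))
    where
    ew≤ : ∂ Γ e w ≤ suc r
    ew≤ = ≤-trans (∂-triangle Γ e a w)
                  (≤-trans (+-mono-≤ ea≤r (≤-reflexive (cong proj₁ aw))) (≤-reflexive (+-comm r 1)))

module CircuitGeometry (Γ : Digraph) (r : ℕ) (C : Circuit Γ (3 + r)) where
  open Circuit C
  open ArcGeometry Γ r

  walk : ∀ k j → ∂ Γ (x j) (x (k + j)) ≤ k
  walk zero    j = ≤-reflexive (∂-refl Γ (x j))
  walk (suc k) j = begin
    ∂ Γ (x j) (x (suc k + j))
      ≤⟨ ∂-triangle Γ (x j) (x (k + j)) (x (suc k + j)) ⟩
    ∂ Γ (x j) (x (k + j)) + ∂ Γ (x (k + j)) (x (suc k + j))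
      ≤⟨ +-mono-≤ (walk k j) (≤-reflexive (cong proj₁ (type1 (k + j)))) ⟩
    k + 1
      ≡⟨ +-comm k 1 ⟩
    suc k ∎
    where open ≤-Reasoning

  walk-back : ∀ k l j → k + l ≡ 3 + r → ∂ Γ (x (k + j)) (x j) ≤ l
  walk-back k l j k+l≡q =
    subst (λ y → ∂ Γ (x (k + j)) y ≤ l) (trans (cong x once-around) (periodic j)) (walk l (k + j))
    where
    open ≡-Reasoning
    once-around : l + (k + j) ≡ j + (3 + r)
    once-around = begin
      l + (k + j) ≡⟨ +-assoc l k j ⟨
      l + k + j   ≡⟨ cong (_+ j) (trans (+-comm l k) k+l≡q) ⟩
      3 + r + j   ≡⟨ +-comm (3 + r) j ⟩
      j + (3 + r) ∎

  skip-type : ∀ j → ∂̃ Γ (x j) (x (2 + j)) ≡ A₂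
  skip-type j = two-step (type1 j) (type1 (1 + j)) (walk-back 2 (suc r) j refl)
                         (∂≢1-via-start (walk-back 3 r j refl) (cong proj₂ (type1 (2 + j))))

  Y-characterisation : IsSchemeWDR Γ → CommutativeScheme Γ → (∀ v → valency Γ v A₁ ≡ valency Γ v A₂)
    → ∀ i w → (Between Γ A₁ A₁ (x (1 + i)) (x (3 + i)) w ⇔ Between Γ A₂ (swap A₁) (x i) (x (1 + i)) w)
            × (Between Γ A₁ A₁ (x (1 + i)) (x (3 + i)) w ⇔ Between Γ (swap A₁) A₂ (x (3 + i)) (x (4 + i)) w)
  Y-characterisation scheme comm k₁≡k₂ i w =
    Between-⇔-via-predecessor Γ scheme (k₁≡k₂ (x i)) (type1 i) (skip-type (1 + i))
      (Between-⊆-predecessor (type1 i) (walk-back 3 r i refl)) w ,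
    Between-⇔-via-successor Γ scheme comm (k₁≡k₂ (x i)) (type1 i) (skip-type (1 + i))
      (type1 (3 + i)) (Between-⊆-successor (type1 (3 + i)) (walk-back 3 r (1 + i) refl)) w

module Translation (Γ : Digraph) (H : CayleyStructure Γ) where
  open CayleyStructure H
  open IsAbelianGroup isAbGrp using (comm; inverseʳ; identityʳ; _-_)

  private
    G : AbelianGroup 0ℓ 0ℓ
    G = record { Carrier = V Γ ; _≈_ = _≡_ ; _∙_ = _⊕_ ; ε = 𝟘 ; _⁻¹ = ⊖_ ; isAbelianGroup = isAbGrp }

  open Algebra.Properties.AbelianGroup G using (//-rightDividesˡ; //-rightDividesʳ; ⁻¹-∙-comm)
  open Algebra.Properties.CommutativeSemigroup (AbelianGroup.commutativeSemigroup G) using (interchange)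
  open Algebra.Properties.CommutativeSemigroup (AbelianGroup.commutativeSemigroup G) public using (x∙yz≈y∙xz)

  x⊕[y-x]≡y : ∀ x y → x ⊕ (y - x) ≡ y
  x⊕[y-x]≡y x y = trans (comm x (y - x)) (//-rightDividesˡ x y)

  [x⊕t]-[y⊕t]≡x-y : ∀ x y t → (x ⊕ t) - (y ⊕ t) ≡ x - y
  [x⊕t]-[y⊕t]≡x-y x y t = begin
    (x ⊕ t) - (y ⊕ t)          ≡⟨ cong ((x ⊕ t) ⊕_) (⁻¹-∙-comm y t) ⟨
    (x ⊕ t) ⊕ ((⊖ y) ⊕ (⊖ t))  ≡⟨ interchange x t (⊖ y) (⊖ t) ⟩
    (x - y) ⊕ (t - t)          ≡⟨ cong ((x - y) ⊕_) (inverseʳ t) ⟩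
    (x - y) ⊕ 𝟘                ≡⟨ identityʳ (x - y) ⟩
    x - y                      ∎
    where open ≡-Reasoning

  translation-adj : ∀ t → PreservesAdjacency Γ (_⊕ t)
  translation-adj t x y = trans (arcs _ _) (trans (cong S ([x⊕t]-[y⊕t]≡x-y y x t)) (sym (arcs x y)))

  ∂̃-translation : ∀ t {a b a′ b′} → a ⊕ t ≡ a′ → b ⊕ t ≡ b′ → ∂̃ Γ a′ b′ ≡ ∂̃ Γ a b
  ∂̃-translation t {a} {b} refl refl =
    ∂̃-invariant Γ (translation-adj t) (translation-adj (⊖ t)) (//-rightDividesʳ t) a b

  Between-translation : ∀ t {h j a b a′ b′} → a ⊕ t ≡ a′ → b ⊕ t ≡ b′
    → ∀ w → Between Γ h j a b w ⇔ Between Γ h j a′ b′ (w ⊕ t)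
  Between-translation t a⊕t b⊕t w = mk⇔
    (λ { (aw , wb) → trans (∂̃-translation t a⊕t refl) aw , trans (∂̃-translation t refl b⊕t) wb })
    (λ { (aw , wb) → trans (sym (∂̃-translation t a⊕t refl)) aw
                   , trans (sym (∂̃-translation t refl b⊕t)) wb })

  -ˢ-translation : ∀ t {Y Y′ : V Γ → Set} {a a′} → (∀ w → Y w ⇔ Y′ (w ⊕ t)) → a ⊕ t ≡ a′
    → ∀ u → (Y -ˢ a) u ⇔ (Y′ -ˢ a′) u
  -ˢ-translation t {Y} {Y′} {a} Y⇔Y′ refl u = mk⇔
    (λ { (w , Yw , u≡) → w ⊕ t , Equivalence.to (Y⇔Y′ w) Yw , trans u≡ (sym ([x⊕t]-[y⊕t]≡x-y w a t)) })
    (λ { (w′ , Y′w′ , u≡) → w′ - t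
         , Equivalence.from (Y⇔Y′ (w′ - t)) (subst Y′ (sym (//-rightDividesˡ t w′)) Y′w′)
         , trans u≡ (trans (cong (_- (a ⊕ t)) (sym (//-rightDividesˡ t w′)))
                           ([x⊕t]-[y⊕t]≡x-y (w′ - t) a t)) })

module CayleyCircuit (Γ : Digraph) (scheme : IsSchemeWDR Γ) (r : ℕ) (C : Circuit Γ (4 + r))
                     (H : CayleyStructure Γ) where
  open Circuit C
  open CayleyStructure H
  open IsAbelianGroup isAbGrp using (assoc; comm; _-_)
  open ArcGeometry Γ (suc r)
  open CircuitGeometry Γ (suc r) C
  open Translation Γ H

  Y-translation : (∀ v → valency Γ v A₁ ≡ valency Γ v A₂)
    → ∀ i u → (Yset Γ (4 + r) (x i) (x (2 + i)) -ˢ x i) u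
            ⇔ (Yset Γ (4 + r) (x (1 + i)) (x (3 + i)) -ˢ x (1 + i)) u
  Y-translation k₁≡k₂ i = -ˢ-translation t Y₀⇔Y₁ (x⊕[y-x]≡y x₀ x₁)
    where
    x₀ x₁ x₂ x₃ x₄ t σ d b : V Γ
    x₀ = x i
    x₁ = x (1 + i)
    x₂ = x (2 + i)
    x₃ = x (3 + i)
    x₄ = x (4 + i)
    t = x₁ - x₀
    σ = x₃ - x₄
    -- d is the image of x₃ under the translation x₄ ↦ x₁, and b that of x₂ under x₀ ↦ x₁.
    d = x₁ ⊕ σ
    b = x₂ ⊕ t

    d→x₁ : ∂̃ Γ d x₁ ≡ A₁
    d→x₁ = trans (∂̃-translation (x₁ - x₄) (x∙yz≈y∙xz x₃ x₁ (⊖ x₄)) (x⊕[y-x]≡y x₄ x₁)) (type1 (3 + i))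

    x₃→d : ∂ Γ x₃ d ≤ suc r
    x₃→d = subst (_≤ suc r) (sym (cong proj₁ (∂̃-translation σ (x⊕[y-x]≡y x₄ x₃) refl)))
                 (walk-back 3 (suc r) (1 + i) refl)

    b→d : ∂ Γ b d ≤ suc r
    b→d = ≤-trans (∂-triangle Γ b (x₃ ⊕ t) d) (+-mono-≤ (≤-reflexive b→x₃⊕t) x₃⊕t→d)
      where
      b→x₃⊕t : ∂ Γ b (x₃ ⊕ t) ≡ 1
      b→x₃⊕t = cong proj₁ (trans (∂̃-translation t refl refl) (type1 (2 + i)))
      x₄↦x₃⊕t : x₄ ⊕ (σ ⊕ t) ≡ x₃ ⊕ t
      x₄↦x₃⊕t = trans (sym (assoc x₄ σ t)) (cong (_⊕ t) (x⊕[y-x]≡y x₄ x₃))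
      x₀↦d : x₀ ⊕ (σ ⊕ t) ≡ d
      x₀↦d = trans (x∙yz≈y∙xz x₀ σ t) (trans (cong (σ ⊕_) (x⊕[y-x]≡y x₀ x₁)) (comm σ x₁))
      x₃⊕t→d : ∂ Γ (x₃ ⊕ t) d ≤ r
      x₃⊕t→d = subst (_≤ r) (sym (cong proj₁ (∂̃-translation (σ ⊕ t) x₄↦x₃⊕t x₀↦d))) (walk-back 4 r i refl)

    x₁→b : ∂̃ Γ x₁ b ≡ A₂
    x₁→b = trans (∂̃-translation t (x⊕[y-x]≡y x₀ x₁) refl) (skip-type i)

    Y₁⇔Z : ∀ v → Between Γ A₁ A₁ x₁ x₃ v ⇔ Between Γ A₂ (swap A₁) d x₁ v
    Y₁⇔Z = Between-⇔-via-predecessor Γ scheme (k₁≡k₂ d) d→x₁ (skip-type (1 + i))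
             (Between-⊆-predecessor d→x₁ x₃→d)

    Yb⇔Z : ∀ v → Between Γ A₁ A₁ x₁ b v ⇔ Between Γ A₂ (swap A₁) d x₁ v
    Yb⇔Z = Between-⇔-via-predecessor Γ scheme (k₁≡k₂ d) d→x₁ x₁→b (Between-⊆-predecessor d→x₁ b→d)

    Y₀⇔Y₁ : ∀ w → Between Γ A₁ A₁ x₀ x₂ w ⇔ Between Γ A₁ A₁ x₁ x₃ (w ⊕ t)
    Y₀⇔Y₁ w = ⇔.trans (Between-translation t (x⊕[y-x]≡y x₀ x₁) refl w)
                      (⇔.trans (Yb⇔Z (w ⊕ t)) (⇔.sym (Y₁⇔Z (w ⊕ t))))

lemma4p2 : (Γ : Digraph) → WeaklyDistanceRegular Γ → CommutativeScheme Γ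
    → (q : ℕ) → 3 ≤ q → (C : Circuit Γ q)
    → (∀ v → valency Γ v (1 , q ∸ 1) ≡ valency Γ v (2 , q ∸ 2))
    → let open Circuit C in
      (∀ i w →
         (Yset Γ q (x (1 + i)) (x (3 + i)) w
           ⇔ (∂̃ Γ (x i) w ≡ (2 , q ∸ 2) × ∂̃ Γ w (x (1 + i)) ≡ (q ∸ 1 , 1)))
         × (Yset Γ q (x (1 + i)) (x (3 + i)) w
           ⇔ (∂̃ Γ (x (3 + i)) w ≡ (q ∸ 1 , 1) × ∂̃ Γ w (x (4 + i)) ≡ (2 , q ∸ 2))))
      × (3 < q → (H : CayleyStructure Γ) → let open CayleyStructure H in
           ∀ i u → (Yset Γ q (x i) (x (2 + i)) -ˢ x i) u
                   ⇔ (Yset Γ q (x (1 + i)) (x (3 + i)) -ˢ x (1 + i)) u)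
lemma4p2 Γ (_ , scheme) comm 3 (s≤s (s≤s (s≤s z≤n))) C k₁≡k₂ =
  CircuitGeometry.Y-characterisation Γ 0 C scheme comm k₁≡k₂ , λ { (s≤s (s≤s (s≤s ()))) }
lemma4p2 Γ (_ , scheme) comm (suc (suc (suc (suc r)))) (s≤s (s≤s (s≤s z≤n))) C k₁≡k₂ =
  CircuitGeometry.Y-characterisation Γ (suc r) C scheme comm k₁≡k₂ ,
  λ _ H → CayleyCircuit.Y-translation Γ scheme r C H k₁≡k₂
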